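{- Fix integers $\Delta\geq \delta\geq 1$ and let $f$ be a real-valued function on pairs of positive integers with $f(x,y)=f(y,x)$ for all $x,y$, and let $F(G)=\sum_{uv\in E(G)}f(d(u),d(v))$. Let $a,b\in \{\delta,\ldots,\Delta\}$ with $a\leq b$ be chosen to minimise $\frac{ab\,f(a,b)}{a+b}$. Then any graph $G$ with minimum degree at least $\delta$ and maximum degree at most $\Delta$ satisfies $F(G)\geq \frac{ab\,f(a,b)}{a+b}|G|$. Equality occurs if $G$ is $(a,b)$-biregular, and, provided the choice of the pair $(a,b)$ is unique, this is the only case in which equality occurs.
   Context: Graphs are finite and simple; $|G|$ denotes the number of vertices of $G$ and $d(u)$ the degree of a vertex $u$. For integers $r,s\geq 1$, a graph is $(r,s)$-biregular if every vertex has degree either $r$ or $s$ and every edge has one endpoint of each of these degrees ($(r,r)$-biregular means $r$-regular). -}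

module Defs where

open import Level using (Level; _⊔_)
open import Algebra.Bundles using (CommutativeRing)
open import Relation.Binary.Structures using (IsTotalOrder)
open import Relation.Nullary using (¬_; yes; no)
open import Data.Nat as ℕ using (ℕ)
open import Data.Fin as Fin using (Fin; toℕ)
open import Data.Bool using (Bool; true; false; if_then_else_)
open import Data.Product using (_×_)
open import Data.Sum using (_⊎_)
open import Relation.Binary.PropositionalEquality using (_≡_)

-- The real numbers are one;
-- the theorem is stated for an arbitrary ordered field, which includes ℝ.
-- Inverse is a total function with the usual axiom for nonzero elements.

record OrderedField (c ℓ₁ ℓ₂ : Level) : Set (Level.suc (c ⊔ ℓ₁ ⊔ ℓ₂)) where
  field
    commutativeRing : CommutativeRing c ℓ₁
  open CommutativeRing commutativeRing public
    using (Carrier; _≈_; _+_; _*_; -_; 0#; 1#)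
  infix 4 _≤_
  infix 8 _⁻¹
  field
    _≤_           : Carrier → Carrier → Set ℓ₂
    isTotalOrder  : IsTotalOrder _≈_ _≤_
    +-mono-≤      : ∀ {x y} z → x ≤ y → x + z ≤ y + z
    *-nonneg      : ∀ {x y} → 0# ≤ x → 0# ≤ y → 0# ≤ x * y
    0≉1           : ¬ (0# ≈ 1#)
    _⁻¹           : Carrier → Carrier
    ⁻¹-inverse    : ∀ x → ¬ (x ≈ 0#) → x * (x ⁻¹) ≈ 1#

  fromℕ : ℕ → Carrier
  fromℕ ℕ.zero    = 0#
  fromℕ (ℕ.suc n) = 1# + fromℕ n

  sumF : (n : ℕ) → (Fin n → Carrier) → Carrier
  sumF ℕ.zero    g = 0#
  sumF (ℕ.suc n) g = g Fin.zero + sumF n (λ i → g (Fin.suc i))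

-- Finite simple graphs on vertex set Fin n (so |G| = n).

record Graph (n : ℕ) : Set where
  field
    adj     : Fin n → Fin n → Bool
    sym     : ∀ i j → adj i j ≡ adj j i
    irrefl  : ∀ i → adj i i ≡ false

sumℕ : (n : ℕ) → (Fin n → ℕ) → ℕ
sumℕ ℕ.zero    g = 0
sumℕ (ℕ.suc n) g = g Fin.zero ℕ.+ sumℕ n (λ i → g (Fin.suc i))

deg : ∀ {n} → Graph n → Fin n → ℕ
deg {n} G i = sumℕ n (λ j → if Graph.adj G i j then 1 else 0)

DegreesBetween : ℕ → ℕ → ∀ {n} → Graph n → Set
DegreesBetween δ Δ G = ∀ i → δ ℕ.≤ deg G i × deg G i ℕ.≤ Δ

Biregular : ℕ → ℕ → ∀ {n} → Graph n → Set
Biregular r s G =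
  (∀ i → deg G i ≡ r ⊎ deg G i ≡ s) ×
  (∀ i j → Graph.adj G i j ≡ true →
     (deg G i ≡ r × deg G j ≡ s) ⊎ (deg G i ≡ s × deg G j ≡ r))

module _ {c ℓ₁ ℓ₂} (K : OrderedField c ℓ₁ ℓ₂) where
  open OrderedField K

  edgeSum : (ℕ → ℕ → Carrier) → ∀ {n} → Graph n → Carrier
  edgeSum f {n} G =
    sumF n (λ i → sumF n (λ j →
      if Graph.adj G i j
        then (if toℕ i ℕ.<ᵇ toℕ j then f (deg G i) (deg G j) else 0#)
        else 0#))

  ratio : (ℕ → ℕ → Carrier) → ℕ → ℕ → Carrier
  ratio f x y = (fromℕ x * fromℕ y * f x y) * (fromℕ (x ℕ.+ y) ⁻¹)

-- Write r for the minimal value of x y f(x,y) / (x + y) and share(x) = r / x.  Every vertex i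
-- spreads r over its d(i) edges, so r |G| = Σ_{uv ∈ E(G)} (share(d u) + share(d v)) and
--   F(G) − r |G| = Σ_{uv ∈ E(G)} (f(d u, d v) − share(d u) − share(d v)).
-- Each summand equals ((x + y) / x y) (ratio(x, y) − r) with x = d u, y = d v, hence is
-- nonnegative, and it vanishes exactly when ratio(x, y) = r, i.e. when {x, y} = {a, b} if the
-- minimiser is unique.  As every vertex lies on an edge, equality forces (a,b)-biregularity.
module Submission where

open import Defs
import Data.Nat as N
open import Data.Nat using (ℕ; zero; suc; _≤_)
import Data.Nat.Properties as NP
open import Data.Fin using (Fin; toℕ)
import Data.Fin as Fin
open import Data.Fin.Properties using (toℕ-injective)
open import Data.Bool using (Bool; true; false; if_then_else_)
open import Data.Product using (_×_; _,_; proj₁; proj₂; ∃)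
open import Data.Sum using (_⊎_; inj₁; inj₂)
open import Data.Empty using (⊥-elim)
open import Function using (_∘_)
open import Data.Maybe using (nothing)
open import Relation.Nullary using (¬_)
open import Relation.Binary.PropositionalEquality as P using (_≡_; _≢_)
open import Algebra.Bundles using (CommutativeRing)
open import Relation.Binary.Structures using (IsTotalOrder)

≢⇒<ᵇ-exclusive : ∀ m k → m ≢ k →
  ((m N.<ᵇ k) ≡ true × (k N.<ᵇ m) ≡ false) ⊎ ((m N.<ᵇ k) ≡ false × (k N.<ᵇ m) ≡ true)
≢⇒<ᵇ-exclusive zero    zero    m≢k = ⊥-elim (m≢k P.refl)
≢⇒<ᵇ-exclusive zero    (suc k) m≢k = inj₁ (P.refl , P.refl)
≢⇒<ᵇ-exclusive (suc m) zero    m≢k = inj₂ (P.refl , P.refl)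
≢⇒<ᵇ-exclusive (suc m) (suc k) m≢k = ≢⇒<ᵇ-exclusive m k (m≢k ∘ P.cong suc)

count-pos⇒∃ : ∀ n (p : Fin n → Bool) → 1 ≤ sumℕ n (λ j → if p j then 1 else 0) →
              ∃ λ j → p j ≡ true
count-pos⇒∃ (suc n) p h with p Fin.zero in p0
... | true  = Fin.zero , p0
... | false with count-pos⇒∃ n (λ j → p (Fin.suc j)) h
...   | j , pj = Fin.suc j , pj

module _ {c ℓ₁ ℓ₂} (K : OrderedField c ℓ₁ ℓ₂) where
  open OrderedField K renaming (_≤_ to _≤K_)
  module R = CommutativeRing commutativeRing
  module ≤K = IsTotalOrder isTotalOrder
  open R using (_-_)
  open import Algebra.Properties.Ring R.ring
    using (-1*x≈-x; -‿involutive; -‿distribʳ-*; x[y-z]≈xy-xz; //-rightDividesˡ;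
           x∙y⁻¹≈ε⇒x≈y; x≈y⇒x∙y⁻¹≈ε; +-identityʳ-unique)
  open import Relation.Binary.Reasoning.Setoid R.setoid
  open import Algebra.Solver.Ring.NaturalCoefficients R.commutativeSemiring (λ _ _ → nothing)

  ≤K-respˡ : ∀ {x y z} → x ≈ y → x ≤K z → y ≤K z
  ≤K-respˡ = ≤K.≲-respˡ-≈

  ≤K-respʳ : ∀ {x y z} → y ≈ z → x ≤K y → x ≤K z
  ≤K-respʳ = ≤K.≲-respʳ-≈

  x≤y⇒0≤y-x : ∀ {x y} → x ≤K y → 0# ≤K y - x
  x≤y⇒0≤y-x {x} x≤y = ≤K-respˡ (R.-‿inverseʳ x) (+-mono-≤ (- x) x≤y)

  0≤y-x⇒x≤y : ∀ {x y} → 0# ≤K y - x → x ≤K y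
  0≤y-x⇒x≤y {x} {y} 0≤y-x =
    ≤K-respʳ (//-rightDividesˡ x y) (≤K-respˡ (R.+-identityˡ x) (+-mono-≤ x 0≤y-x))

  x≤0⇒0≤-x : ∀ {x} → x ≤K 0# → 0# ≤K - x
  x≤0⇒0≤-x x≤0 = ≤K-respʳ (R.+-identityˡ _) (x≤y⇒0≤y-x x≤0)

  0≤-x⇒x≤0 : ∀ {x} → 0# ≤K - x → x ≤K 0#
  0≤-x⇒x≤0 {x} 0≤-x = 0≤y-x⇒x≤y (≤K-respʳ (R.sym (R.+-identityˡ (- x))) 0≤-x)

  x≤x+y : ∀ {x y} → 0# ≤K y → x ≤K x + y
  x≤x+y {x} {y} 0≤y =
    ≤K-respˡ (R.+-identityˡ x) (≤K-respʳ (R.+-comm y x) (+-mono-≤ x 0≤y))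

  0≤+ : ∀ {x y} → 0# ≤K x → 0# ≤K y → 0# ≤K x + y
  0≤+ 0≤x 0≤y = ≤K.trans 0≤x (x≤x+y 0≤y)

  -- if 1 ≤ 0 then 0 ≤ −1, and still 0 ≤ (−1)(−1) = 1
  0≤1 : 0# ≤K 1#
  0≤1 with ≤K.total 0# 1#
  ... | inj₁ 0≤1 = 0≤1
  ... | inj₂ 1≤0 = ≤K-respʳ -1*-1≈1 (*-nonneg 0≤-1 0≤-1)
    where
    0≤-1 : 0# ≤K - 1#
    0≤-1 = x≤0⇒0≤-x 1≤0
    -1*-1≈1 : - 1# * - 1# ≈ 1#
    -1*-1≈1 = R.trans (-1*x≈-x (- 1#)) (-‿involutive 1#)

  1≰0 : ¬ (1# ≤K 0#)
  1≰0 1≤0 = 0≉1 (≤K.antisym 0≤1 1≤0)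

  0≤x⇒0≤x⁻¹ : ∀ {x} → 0# ≤K x → ¬ (x ≈ 0#) → 0# ≤K x ⁻¹
  0≤x⇒0≤x⁻¹ {x} 0≤x x≉0 with ≤K.total 0# (x ⁻¹)
  ... | inj₁ 0≤x⁻¹ = 0≤x⁻¹
  ... | inj₂ x⁻¹≤0 = ⊥-elim (1≰0 (0≤-x⇒x≤0 0≤-1))
    where
    0≤-1 : 0# ≤K - 1#
    0≤-1 = ≤K-respʳ (R.trans (R.sym (-‿distribʳ-* x (x ⁻¹))) (R.-‿cong (⁻¹-inverse x x≉0)))
                    (*-nonneg 0≤x (x≤0⇒0≤-x x⁻¹≤0))

  *-monoˡ-≤-nonneg : ∀ {x y z} → 0# ≤K z → x ≤K y → z * x ≤K z * y
  *-monoˡ-≤-nonneg {x} {y} {z} 0≤z x≤y =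
    0≤y-x⇒x≤y (≤K-respʳ (x[y-z]≈xy-xz z y x) (*-nonneg 0≤z (x≤y⇒0≤y-x x≤y)))

  0≤x∧0≤y∧x+y≈0⇒x≈0 : ∀ {x y} → 0# ≤K x → 0# ≤K y → x + y ≈ 0# → x ≈ 0#
  0≤x∧0≤y∧x+y≈0⇒x≈0 0≤x 0≤y x+y≈0 = ≤K.antisym (≤K-respʳ x+y≈0 (x≤x+y 0≤y)) 0≤x

  0≤fromℕ : ∀ m → 0# ≤K fromℕ m
  0≤fromℕ zero    = ≤K.refl
  0≤fromℕ (suc m) = 0≤+ 0≤1 (0≤fromℕ m)

  fromℕ≉0 : ∀ {m} → 1 ≤ m → ¬ (fromℕ m ≈ 0#)
  fromℕ≉0 {suc m} _ 1+m≈0 = 1≰0 (≤K-respʳ 1+m≈0 (x≤x+y (0≤fromℕ m)))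

  fromℕ-+ : ∀ m k → fromℕ (m N.+ k) ≈ fromℕ m + fromℕ k
  fromℕ-+ zero    k = R.sym (R.+-identityˡ _)
  fromℕ-+ (suc m) k = R.trans (R.+-congˡ (fromℕ-+ m k)) (R.sym (R.+-assoc _ _ _))

  fromℕ*fromℕ⁻¹≈1 : ∀ {m} → 1 ≤ m → fromℕ m * fromℕ m ⁻¹ ≈ 1#
  fromℕ*fromℕ⁻¹≈1 1≤m = ⁻¹-inverse _ (fromℕ≉0 1≤m)

  0≤fromℕ⁻¹ : ∀ {m} → 1 ≤ m → 0# ≤K fromℕ m ⁻¹
  0≤fromℕ⁻¹ {m} 1≤m = 0≤x⇒0≤x⁻¹ (0≤fromℕ m) (fromℕ≉0 1≤m)

  sumF-cong : ∀ n {g h : Fin n → Carrier} → (∀ i → g i ≈ h i) → sumF n g ≈ sumF n h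
  sumF-cong zero    g≈h = R.refl
  sumF-cong (suc n) g≈h = R.+-cong (g≈h Fin.zero) (sumF-cong n (λ i → g≈h (Fin.suc i)))

  sumF-+ : ∀ n (g h : Fin n → Carrier) → sumF n (λ i → g i + h i) ≈ sumF n g + sumF n h
  sumF-+ zero    g h = R.sym (R.+-identityˡ 0#)
  sumF-+ (suc n) g h = R.trans (R.+-congˡ (sumF-+ n _ _))
    (solve 4 (λ a b c d → (a :+ b) :+ (c :+ d) := (a :+ c) :+ (b :+ d)) R.refl
       (g Fin.zero) (h Fin.zero) (sumF n (λ i → g (Fin.suc i))) (sumF n (λ i → h (Fin.suc i))))

  *-distribˡ-sumF : ∀ n x (g : Fin n → Carrier) → x * sumF n g ≈ sumF n (λ i → x * g i)
  *-distribˡ-sumF zero    x g = R.zeroʳ x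
  *-distribˡ-sumF (suc n) x g = R.trans (R.distribˡ x _ _) (R.+-congˡ (*-distribˡ-sumF n x _))

  sumF-const : ∀ n x → sumF n (λ _ → x) ≈ x * fromℕ n
  sumF-const zero    x = R.sym (R.zeroʳ x)
  sumF-const (suc n) x = R.trans (R.+-cong (R.sym (R.*-identityʳ x)) (sumF-const n x))
    (R.sym (R.distribˡ x 1# (fromℕ n)))

  sumF-comm : ∀ n m (g : Fin n → Fin m → Carrier) →
    sumF n (λ i → sumF m (g i)) ≈ sumF m (λ j → sumF n (λ i → g i j))
  sumF-comm zero    m g = R.trans (R.sym (R.zeroˡ (fromℕ m))) (R.sym (sumF-const m 0#))
  sumF-comm (suc n) m g = R.trans (R.+-congˡ (sumF-comm n m _))
    (R.sym (sumF-+ m (g Fin.zero) (λ j → sumF n (λ i → g (Fin.suc i) j))))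

  0≤sumF : ∀ n (g : Fin n → Carrier) → (∀ i → 0# ≤K g i) → 0# ≤K sumF n g
  0≤sumF zero    g 0≤g = ≤K.refl
  0≤sumF (suc n) g 0≤g = 0≤+ (0≤g Fin.zero) (0≤sumF n _ (λ i → 0≤g (Fin.suc i)))

  sumF≈0⇒≈0 : ∀ n (g : Fin n → Carrier) → (∀ i → 0# ≤K g i) → sumF n g ≈ 0# →
              ∀ i → g i ≈ 0#
  sumF≈0⇒≈0 (suc n) g 0≤g Σ≈0 Fin.zero =
    0≤x∧0≤y∧x+y≈0⇒x≈0 (0≤g Fin.zero) (0≤sumF n _ (λ i → 0≤g (Fin.suc i))) Σ≈0
  sumF≈0⇒≈0 (suc n) g 0≤g Σ≈0 (Fin.suc i) =
    sumF≈0⇒≈0 n _ (λ i → 0≤g (Fin.suc i))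
      (0≤x∧0≤y∧x+y≈0⇒x≈0 (0≤sumF n _ (λ i → 0≤g (Fin.suc i))) (0≤g Fin.zero)
        (R.trans (R.+-comm _ _) Σ≈0)) i

  fromℕ-sumℕ : ∀ n (g : Fin n → ℕ) → fromℕ (sumℕ n g) ≈ sumF n (λ i → fromℕ (g i))
  fromℕ-sumℕ zero    g = R.refl
  fromℕ-sumℕ (suc n) g = R.trans (fromℕ-+ (g Fin.zero) _) (R.+-congˡ (fromℕ-sumℕ n _))

  share : Carrier → ℕ → Carrier
  share r x = r * fromℕ x ⁻¹

  excess : (ℕ → ℕ → Carrier) → Carrier → ℕ → ℕ → Carrier
  excess f r x y = f x y - (share r x + share r y)

  weight : ℕ → ℕ → Carrier
  weight x y = fromℕ x ⁻¹ * fromℕ y ⁻¹ * fromℕ (x N.+ y)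

  module _ {x y : ℕ} (1≤x : 1 ≤ x) (1≤y : 1 ≤ y) where
    private
      X Y S : Carrier
      X = fromℕ x
      Y = fromℕ y
      S = fromℕ (x N.+ y)
      XX⁻¹≈1 : X * X ⁻¹ ≈ 1#
      XX⁻¹≈1 = fromℕ*fromℕ⁻¹≈1 1≤x
      YY⁻¹≈1 : Y * Y ⁻¹ ≈ 1#
      YY⁻¹≈1 = fromℕ*fromℕ⁻¹≈1 1≤y
      SS⁻¹≈1 : S * S ⁻¹ ≈ 1#
      SS⁻¹≈1 = fromℕ*fromℕ⁻¹≈1 (NP.≤-trans 1≤x (NP.m≤m+n x y))

    0≤weight : 0# ≤K weight x y
    0≤weight = *-nonneg (*-nonneg (0≤fromℕ⁻¹ 1≤x) (0≤fromℕ⁻¹ 1≤y)) (0≤fromℕ (x N.+ y))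

    weight-invertible : X * Y * S ⁻¹ * weight x y ≈ 1#
    weight-invertible = begin
      X * Y * S ⁻¹ * weight x y
        ≈⟨ solve 6 (λ x y s x⁻¹ y⁻¹ s⁻¹ → x :* y :* s⁻¹ :* (x⁻¹ :* y⁻¹ :* s)
                      := (x :* x⁻¹) :* (y :* y⁻¹) :* (s :* s⁻¹))
                 R.refl X Y S (X ⁻¹) (Y ⁻¹) (S ⁻¹) ⟩
      (X * X ⁻¹) * (Y * Y ⁻¹) * (S * S ⁻¹) ≈⟨ R.*-cong (R.*-cong XX⁻¹≈1 YY⁻¹≈1) SS⁻¹≈1 ⟩
      1# * 1# * 1#                         ≈⟨ R.trans (R.*-identityʳ _) (R.*-identityʳ _) ⟩
      1#                                   ∎

    weight*ratio≈f : ∀ f → weight x y * ratio K f x y ≈ f x y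
    weight*ratio≈f f = begin
      weight x y * ratio K f x y
        ≈⟨ solve 7 (λ x y s x⁻¹ y⁻¹ s⁻¹ v → x⁻¹ :* y⁻¹ :* s :* (x :* y :* v :* s⁻¹)
                      := (x :* x⁻¹) :* (y :* y⁻¹) :* (s :* s⁻¹) :* v)
                 R.refl X Y S (X ⁻¹) (Y ⁻¹) (S ⁻¹) (f x y) ⟩
      (X * X ⁻¹) * (Y * Y ⁻¹) * (S * S ⁻¹) * f x y
        ≈⟨ R.*-cong (R.*-cong (R.*-cong XX⁻¹≈1 YY⁻¹≈1) SS⁻¹≈1) R.refl ⟩
      1# * 1# * 1# * f x y
        ≈⟨ R.trans (R.*-congʳ (R.trans (R.*-identityʳ _) (R.*-identityʳ _))) (R.*-identityˡ _) ⟩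
      f x y ∎

    weight*r≈shares : ∀ r → weight x y * r ≈ share r x + share r y
    weight*r≈shares r = begin
      weight x y * r                              ≈⟨ R.*-congʳ (R.*-congˡ (fromℕ-+ x y)) ⟩
      X ⁻¹ * Y ⁻¹ * (X + Y) * r
        ≈⟨ solve 5 (λ x y x⁻¹ y⁻¹ r → x⁻¹ :* y⁻¹ :* (x :+ y) :* r
                      := r :* x⁻¹ :* (y :* y⁻¹) :+ r :* y⁻¹ :* (x :* x⁻¹))
                 R.refl X Y (X ⁻¹) (Y ⁻¹) r ⟩
      share r x * (Y * Y ⁻¹) + share r y * (X * X ⁻¹)
        ≈⟨ R.+-cong (R.*-congˡ YY⁻¹≈1) (R.*-congˡ XX⁻¹≈1) ⟩
      share r x * 1# + share r y * 1#
        ≈⟨ R.+-cong (R.*-identityʳ _) (R.*-identityʳ _) ⟩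
      share r x + share r y ∎

    excess≈weight*[ratio-r] : ∀ f r → excess f r x y ≈ weight x y * (ratio K f x y - r)
    excess≈weight*[ratio-r] f r = R.sym (begin
      weight x y * (ratio K f x y - r)             ≈⟨ x[y-z]≈xy-xz _ _ _ ⟩
      weight x y * ratio K f x y - weight x y * r  ≈⟨ R.+-cong (weight*ratio≈f f)
                                                               (R.-‿cong (weight*r≈shares r)) ⟩
      excess f r x y                               ∎)

    ratio≥r⇒0≤excess : ∀ f r → r ≤K ratio K f x y → 0# ≤K excess f r x y
    ratio≥r⇒0≤excess f r r≤ratio =
      ≤K-respʳ (R.sym (excess≈weight*[ratio-r] f r)) (*-nonneg 0≤weight (x≤y⇒0≤y-x r≤ratio))

    ratio≈r⇒excess≈0 : ∀ f r → ratio K f x y ≈ r → excess f r x y ≈ 0#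
    ratio≈r⇒excess≈0 f r ratio≈r = begin
      excess f r x y                    ≈⟨ excess≈weight*[ratio-r] f r ⟩
      weight x y * (ratio K f x y - r)  ≈⟨ R.*-congˡ (x≈y⇒x∙y⁻¹≈ε ratio≈r) ⟩
      weight x y * 0#                   ≈⟨ R.zeroʳ _ ⟩
      0#                                ∎

    excess≈0⇒ratio≈r : ∀ f r → excess f r x y ≈ 0# → ratio K f x y ≈ r
    excess≈0⇒ratio≈r f r excess≈0 = x∙y⁻¹≈ε⇒x≈y _ _ (begin
      ratio K f x y - r                              ≈⟨ R.*-identityˡ _ ⟨
      1# * (ratio K f x y - r)                       ≈⟨ R.*-congʳ weight-invertible ⟨
      X * Y * S ⁻¹ * weight x y * (ratio K f x y - r) ≈⟨ R.*-assoc _ _ _ ⟩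
      X * Y * S ⁻¹ * (weight x y * (ratio K f x y - r)) ≈⟨ R.*-congˡ (excess≈weight*[ratio-r] f r) ⟨
      X * Y * S ⁻¹ * excess f r x y                  ≈⟨ R.*-congˡ excess≈0 ⟩
      X * Y * S ⁻¹ * 0#                              ≈⟨ R.zeroʳ _ ⟩
      0#                                             ∎)

  share*fromℕ≈r : ∀ r {x} → 1 ≤ x → share r x * fromℕ x ≈ r
  share*fromℕ≈r r {x} 1≤x = begin
    r * fromℕ x ⁻¹ * fromℕ x   ≈⟨ R.*-assoc _ _ _ ⟩
    r * (fromℕ x ⁻¹ * fromℕ x) ≈⟨ R.*-congˡ (R.trans (R.*-comm _ _) (fromℕ*fromℕ⁻¹≈1 1≤x)) ⟩
    r * 1#                     ≈⟨ R.*-identityʳ r ⟩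
    r                          ∎

  excess-comm : ∀ f r {x y} → f x y ≈ f y x → excess f r x y ≈ excess f r y x
  excess-comm f r fxy≈fyx = R.+-cong fxy≈fyx (R.-‿cong (R.+-comm _ _))

  PositiveSymmetric : (ℕ → ℕ → Carrier) → Set ℓ₁
  PositiveSymmetric f = ∀ x y → 1 ≤ x → 1 ≤ y → f x y ≈ f y x

  RatioLowerBound : ℕ → ℕ → (ℕ → ℕ → Carrier) → Carrier → Set ℓ₂
  RatioLowerBound δ Δ f r = ∀ x y → δ ≤ x → x ≤ y → y ≤ Δ → r ≤K ratio K f x y

  RatioAttainedOnlyAt : ℕ → ℕ → (ℕ → ℕ → Carrier) → Carrier → ℕ → ℕ → Set ℓ₁
  RatioAttainedOnlyAt δ Δ f r a b =
    ∀ x y → δ ≤ x → x ≤ y → y ≤ Δ → ratio K f x y ≈ r → x ≡ a × y ≡ b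

  module _ {δ Δ : ℕ} (1≤δ : 1 ≤ δ) {f : ℕ → ℕ → Carrier} (f-sym : PositiveSymmetric f)
           {r : Carrier} (r≤ratio : RatioLowerBound δ Δ f r)
           {x y : ℕ} (δ≤x : δ ≤ x) (x≤Δ : x ≤ Δ) (δ≤y : δ ≤ y) (y≤Δ : y ≤ Δ) where
    private
      1≤x : 1 ≤ x
      1≤x = NP.≤-trans 1≤δ δ≤x
      1≤y : 1 ≤ y
      1≤y = NP.≤-trans 1≤δ δ≤y

    0≤excess : 0# ≤K excess f r x y
    0≤excess with NP.≤-total x y
    ... | inj₁ x≤y = ratio≥r⇒0≤excess 1≤x 1≤y f r (r≤ratio x y δ≤x x≤y y≤Δ)
    ... | inj₂ y≤x = ≤K-respʳ (excess-comm f r (f-sym y x 1≤y 1≤x))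
                              (ratio≥r⇒0≤excess 1≤y 1≤x f r (r≤ratio y x δ≤y y≤x x≤Δ))

    excess≈0⇒degrees : ∀ {a b} → RatioAttainedOnlyAt δ Δ f r a b → excess f r x y ≈ 0# →
                       (x ≡ a × y ≡ b) ⊎ (x ≡ b × y ≡ a)
    excess≈0⇒degrees only excess≈0 with NP.≤-total x y
    ... | inj₁ x≤y = inj₁ (only x y δ≤x x≤y y≤Δ (excess≈0⇒ratio≈r 1≤x 1≤y f r excess≈0))
    ... | inj₂ y≤x with only y x δ≤y y≤x x≤Δ
             (excess≈0⇒ratio≈r 1≤y 1≤x f r
               (R.trans (excess-comm f r (f-sym y x 1≤y 1≤x)) excess≈0))
    ...   | y≡a , x≡b = inj₂ (x≡b , y≡a)

  guard : Bool → Carrier → Carrier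
  guard b v = if b then v else 0#

  guard-cong : ∀ b {v w} → v ≈ w → guard b v ≈ guard b w
  guard-cong true  v≈w = v≈w
  guard-cong false v≈w = R.refl

  guard-+ : ∀ b v w → guard b (v + w) ≈ guard b v + guard b w
  guard-+ true  v w = R.refl
  guard-+ false v w = R.sym (R.+-identityˡ 0#)

  0≤guard : ∀ b {v} → (b ≡ true → 0# ≤K v) → 0# ≤K guard b v
  0≤guard true  0≤v = 0≤v P.refl
  0≤guard false 0≤v = ≤K.refl

  guard≈0 : ∀ b {v} → (b ≡ true → v ≈ 0#) → guard b v ≈ 0#
  guard≈0 true  v≈0 = v≈0 P.refl
  guard≈0 false v≈0 = R.refl

  guard-true : ∀ {b} v → b ≡ true → guard b v ≡ v
  guard-true v P.refl = P.refl

  guard-split : ∀ b c d v → (b ≡ true → (c ≡ true × d ≡ false) ⊎ (c ≡ false × d ≡ true)) →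
                guard b v ≈ guard b (guard c v) + guard b (guard d v)
  guard-split false c d v c⊕d = R.sym (R.+-identityˡ 0#)
  guard-split true  c d v c⊕d with c⊕d P.refl
  ... | inj₁ (P.refl , P.refl) = R.sym (R.+-identityʳ v)
  ... | inj₂ (P.refl , P.refl) = R.sym (R.+-identityˡ v)

  *-indicator : ∀ b v → v * fromℕ (if b then 1 else 0) ≈ guard b v
  *-indicator true  v = R.trans (R.*-congˡ (R.+-identityʳ 1#)) (R.*-identityʳ v)
  *-indicator false v = R.zeroʳ v

  module _ {n : ℕ} (G : Graph n) where
    open Graph G using (adj)

    private
      _≺_ : Fin n → Fin n → Bool
      i ≺ j = toℕ i N.<ᵇ toℕ j

    sumEdges : (Fin n → Fin n → Carrier) → Carrier
    sumEdges g = sumF n (λ i → sumF n (λ j → guard (adj i j) (guard (i ≺ j) (g i j))))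

    adj⇒toℕ≢ : ∀ {i j} → adj i j ≡ true → toℕ i ≢ toℕ j
    adj⇒toℕ≢ {i} adj-ij i≡j with toℕ-injective i≡j
    ... | P.refl with P.trans (P.sym adj-ij) (Graph.irrefl G i)
    ...   | ()

    sumEdges-+ : ∀ g h → sumEdges (λ i j → g i j + h i j) ≈ sumEdges g + sumEdges h
    sumEdges-+ g h = begin
      sumEdges (λ i j → g i j + h i j)
        ≈⟨ sumF-cong n (λ i → sumF-cong n (λ j →
             R.trans (guard-cong (adj i j) (guard-+ (i ≺ j) _ _)) (guard-+ (adj i j) _ _))) ⟩
      sumF n (λ i → sumF n (λ j → G[ g ] i j + G[ h ] i j))
        ≈⟨ sumF-cong n (λ i → sumF-+ n _ _) ⟩
      sumF n (λ i → sumF n (G[ g ] i) + sumF n (G[ h ] i))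
        ≈⟨ sumF-+ n _ _ ⟩
      sumEdges g + sumEdges h ∎
      where
      G[_] : (Fin n → Fin n → Carrier) → Fin n → Fin n → Carrier
      G[ g ] i j = guard (adj i j) (guard (i ≺ j) (g i j))

    0≤sumEdges : ∀ g → (∀ i j → adj i j ≡ true → 0# ≤K g i j) → 0# ≤K sumEdges g
    0≤sumEdges g 0≤g = 0≤sumF n _ (λ i → 0≤sumF n _ (λ j →
      0≤guard (adj i j) (λ adj-ij → 0≤guard (i ≺ j) (λ _ → 0≤g i j adj-ij))))

    sumEdges≈0 : ∀ g → (∀ i j → adj i j ≡ true → g i j ≈ 0#) → sumEdges g ≈ 0#
    sumEdges≈0 g g≈0 = R.trans
      (sumF-cong n (λ i → R.trans
        (sumF-cong n (λ j → guard≈0 (adj i j) (λ adj-ij → guard≈0 (i ≺ j) (λ _ → g≈0 i j adj-ij))))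
        (R.trans (sumF-const n 0#) (R.zeroˡ _))))
      (R.trans (sumF-const n 0#) (R.zeroˡ _))

    sumEdges≈0⇒≈0 : ∀ g → (∀ i j → adj i j ≡ true → 0# ≤K g i j) → sumEdges g ≈ 0# →
                    ∀ i j → adj i j ≡ true → i ≺ j ≡ true → g i j ≈ 0#
    sumEdges≈0⇒≈0 g 0≤g Σ≈0 i j adj-ij i≺j = begin
      g i j                                  ≡⟨ P.sym (guard-true _ i≺j) ⟩
      guard (i ≺ j) (g i j)                  ≡⟨ P.sym (guard-true _ adj-ij) ⟩
      guard (adj i j) (guard (i ≺ j) (g i j)) ≈⟨ sumF≈0⇒≈0 n _ (0≤term i) row≈0 j ⟩
      0#                                     ∎
      where
      0≤term : ∀ i j → 0# ≤K guard (adj i j) (guard (i ≺ j) (g i j))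
      0≤term i j = 0≤guard (adj i j) (λ adj-ij → 0≤guard (i ≺ j) (λ _ → 0≤g i j adj-ij))
      row≈0 : sumF n (λ j → guard (adj i j) (guard (i ≺ j) (g i j))) ≈ 0#
      row≈0 = sumF≈0⇒≈0 n _ (λ i → 0≤sumF n _ (0≤term i)) Σ≈0 i

    sum-deg*≈sumEdges : (u : Fin n → Carrier) →
                        sumF n (λ i → u i * fromℕ (deg G i)) ≈ sumEdges (λ i j → u i + u j)
    sum-deg*≈sumEdges u = begin
      sumF n (λ i → u i * fromℕ (deg G i))
        ≈⟨ sumF-cong n (λ i → R.*-congˡ (fromℕ-sumℕ n _)) ⟩
      sumF n (λ i → u i * sumF n (λ j → fromℕ (if adj i j then 1 else 0)))
        ≈⟨ sumF-cong n (λ i → R.trans (*-distribˡ-sumF n (u i) _)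
                                       (sumF-cong n (λ j → *-indicator (adj i j) (u i)))) ⟩
      sumF n (λ i → sumF n (λ j → guard (adj i j) (u i)))
        ≈⟨ sumF-cong n (λ i → sumF-cong n (λ j → split i j)) ⟩
      sumF n (λ i → sumF n (λ j → forward i j + backward i j))
        ≈⟨ R.trans (sumF-cong n (λ i → sumF-+ n (forward i) (backward i)))
                   (sumF-+ n (λ i → sumF n (forward i)) (λ i → sumF n (backward i))) ⟩
      sumEdges (λ i j → u i) + sumF n (λ i → sumF n (backward i))
        ≈⟨ R.+-congˡ (R.trans (sumF-comm n n backward)
             (sumF-cong n (λ j → sumF-cong n (λ i →
               R.reflexive (P.cong (λ b → guard b (guard (j ≺ i) (u i))) (Graph.sym G i j)))))) ⟩
      sumEdges (λ i j → u i) + sumEdges (λ i j → u j)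
        ≈⟨ sumEdges-+ (λ i j → u i) (λ i j → u j) ⟨
      sumEdges (λ i j → u i + u j) ∎
      where
      forward backward : Fin n → Fin n → Carrier
      forward  i j = guard (adj i j) (guard (i ≺ j) (u i))
      backward i j = guard (adj i j) (guard (j ≺ i) (u i))
      split : ∀ i j → guard (adj i j) (u i) ≈ forward i j + backward i j
      split i j = guard-split (adj i j) (i ≺ j) (j ≺ i) (u i)
                    (λ adj-ij → ≢⇒<ᵇ-exclusive (toℕ i) (toℕ j) (adj⇒toℕ≢ adj-ij))

    edgeSum≈r*n+excesses : ∀ f r → (∀ i → 1 ≤ deg G i) →
      edgeSum K f G ≈ r * fromℕ n + sumEdges (λ i j → excess f r (deg G i) (deg G j))
    edgeSum≈r*n+excesses f r 1≤deg = begin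
      edgeSum K f G
        ≈⟨ sumF-cong n (λ i → sumF-cong n (λ j → guard-cong (adj i j) (guard-cong (i ≺ j)
             (R.sym (//-rightDividesˡ (s i + s j) (f (deg G i) (deg G j))))))) ⟩
      sumEdges (λ i j → excess f r (deg G i) (deg G j) + (s i + s j))
        ≈⟨ sumEdges-+ (λ i j → excess f r (deg G i) (deg G j)) (λ i j → s i + s j) ⟩
      sumEdges (λ i j → excess f r (deg G i) (deg G j)) + sumEdges (λ i j → s i + s j)
        ≈⟨ R.+-congˡ (sum-deg*≈sumEdges s) ⟨
      sumEdges (λ i j → excess f r (deg G i) (deg G j)) + sumF n (λ i → s i * fromℕ (deg G i))
        ≈⟨ R.+-congˡ (R.trans (sumF-cong n (λ i → share*fromℕ≈r r (1≤deg i))) (sumF-const n r)) ⟩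
      sumEdges (λ i j → excess f r (deg G i) (deg G j)) + r * fromℕ n
        ≈⟨ R.+-comm _ _ ⟩
      r * fromℕ n + sumEdges (λ i j → excess f r (deg G i) (deg G j)) ∎
      where
      s : Fin n → Carrier
      s i = share r (deg G i)

    module _ {δ Δ : ℕ} (1≤δ : 1 ≤ δ) {f : ℕ → ℕ → Carrier} (f-sym : PositiveSymmetric f)
             {r : Carrier} (r≤ratio : RatioLowerBound δ Δ f r) (degs : DegreesBetween δ Δ G) where
      private
        1≤deg : ∀ i → 1 ≤ deg G i
        1≤deg i = NP.≤-trans 1≤δ (proj₁ (degs i))

        0≤excesses : ∀ i j → adj i j ≡ true → 0# ≤K excess f r (deg G i) (deg G j)
        0≤excesses i j _ = 0≤excess 1≤δ f-sym r≤ratio (proj₁ (degs i)) (proj₂ (degs i))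
                                                       (proj₁ (degs j)) (proj₂ (degs j))

      r*n≤edgeSum : r * fromℕ n ≤K edgeSum K f G
      r*n≤edgeSum = ≤K-respʳ (R.sym (edgeSum≈r*n+excesses f r 1≤deg))
                             (x≤x+y (0≤sumEdges _ 0≤excesses))

      edgeSum≈r*n⇒biregular : ∀ {a b} → RatioAttainedOnlyAt δ Δ f r a b →
                              edgeSum K f G ≈ r * fromℕ n → Biregular a b G
      edgeSum≈r*n⇒biregular {a} {b} only tight = vertex-degrees , edge-degrees
        where
        excesses≈0 : sumEdges (λ i j → excess f r (deg G i) (deg G j)) ≈ 0#
        excesses≈0 = +-identityʳ-unique _ _ (R.trans (R.sym (edgeSum≈r*n+excesses f r 1≤deg)) tight)

        EdgeDegrees : Fin n → Fin n → Set
        EdgeDegrees i j = (deg G i ≡ a × deg G j ≡ b) ⊎ (deg G i ≡ b × deg G j ≡ a)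

        ordered-edge-degrees : ∀ i j → adj i j ≡ true → i ≺ j ≡ true → EdgeDegrees i j
        ordered-edge-degrees i j adj-ij i≺j =
          excess≈0⇒degrees 1≤δ f-sym r≤ratio (proj₁ (degs i)) (proj₂ (degs i))
                                              (proj₁ (degs j)) (proj₂ (degs j)) only
            (sumEdges≈0⇒≈0 _ 0≤excesses excesses≈0 i j adj-ij i≺j)

        edge-degrees : ∀ i j → adj i j ≡ true → EdgeDegrees i j
        edge-degrees i j adj-ij with ≢⇒<ᵇ-exclusive (toℕ i) (toℕ j) (adj⇒toℕ≢ adj-ij)
        ... | inj₁ (i≺j , _) = ordered-edge-degrees i j adj-ij i≺j
        ... | inj₂ (_ , j≺i) with ordered-edge-degrees j i (P.trans (Graph.sym G j i) adj-ij) j≺i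
        ...   | inj₁ (j≡a , i≡b) = inj₂ (i≡b , j≡a)
        ...   | inj₂ (j≡b , i≡a) = inj₁ (i≡a , j≡b)

        vertex-degrees : ∀ i → deg G i ≡ a ⊎ deg G i ≡ b
        vertex-degrees i with count-pos⇒∃ n (adj i) (1≤deg i)
        ... | j , adj-ij with edge-degrees i j adj-ij
        ...   | inj₁ (i≡a , _) = inj₁ i≡a
        ...   | inj₂ (i≡b , _) = inj₂ i≡b

    edgeSum-biregular : ∀ {a b} → 1 ≤ a → 1 ≤ b → ∀ {f} → PositiveSymmetric f →
                        Biregular a b G → edgeSum K f G ≈ ratio K f a b * fromℕ n
    edgeSum-biregular {a} {b} 1≤a 1≤b {f} f-sym (vertex-degrees , edge-degrees) = begin
      edgeSum K f G
        ≈⟨ edgeSum≈r*n+excesses f r 1≤deg ⟩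
      r * fromℕ n + sumEdges (λ i j → excess f r (deg G i) (deg G j))
        ≈⟨ R.+-congˡ (sumEdges≈0 _ (λ i j adj-ij → excess≈0 (edge-degrees i j adj-ij))) ⟩
      r * fromℕ n + 0#
        ≈⟨ R.+-identityʳ _ ⟩
      r * fromℕ n ∎
      where
      r : Carrier
      r = ratio K f a b

      1≤deg : ∀ i → 1 ≤ deg G i
      1≤deg i with vertex-degrees i
      ... | inj₁ di≡a = P.subst (1 ≤_) (P.sym di≡a) 1≤a
      ... | inj₂ di≡b = P.subst (1 ≤_) (P.sym di≡b) 1≤b

      excess-ab≈0 : excess f r a b ≈ 0#
      excess-ab≈0 = ratio≈r⇒excess≈0 1≤a 1≤b f r R.refl

      excess≈0 : ∀ {x y} → (x ≡ a × y ≡ b) ⊎ (x ≡ b × y ≡ a) → excess f r x y ≈ 0#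
      excess≈0 (inj₁ (P.refl , P.refl)) = excess-ab≈0
      excess≈0 (inj₂ (P.refl , P.refl)) = R.trans (excess-comm f r (f-sym b a 1≤b 1≤a)) excess-ab≈0

theorem1 : ∀ {c ℓ₁ ℓ₂} (K : OrderedField c ℓ₁ ℓ₂) →
    let open OrderedField K renaming (_≤_ to _≤K_) in
    (δ Δ : ℕ) → 1 ≤ δ → δ ≤ Δ →
    (f : ℕ → ℕ → Carrier) →
    (∀ x y → 1 ≤ x → 1 ≤ y → f x y ≈ f y x) →
    (a b : ℕ) → δ ≤ a → a ≤ b → b ≤ Δ →
    (∀ x y → δ ≤ x → x ≤ y → y ≤ Δ → ratio K f a b ≤K ratio K f x y) →
    ((∀ {n} (G : Graph n) → DegreesBetween δ Δ G →
        ratio K f a b * fromℕ n ≤K edgeSum K f G)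
     × (∀ {n} (G : Graph n) → Biregular a b G →
        edgeSum K f G ≈ ratio K f a b * fromℕ n)
     × ((∀ x y → δ ≤ x → x ≤ y → y ≤ Δ →
           ratio K f x y ≈ ratio K f a b → x ≡ a × y ≡ b) →
        ∀ {n} (G : Graph n) → DegreesBetween δ Δ G →
        edgeSum K f G ≈ ratio K f a b * fromℕ n → Biregular a b G))
theorem1 K δ Δ 1≤δ δ≤Δ f f-sym a b δ≤a a≤b b≤Δ minimal =
    (λ G degs → r*n≤edgeSum K G 1≤δ f-sym minimal degs)
  , (λ G → edgeSum-biregular K G 1≤a 1≤b f-sym)
  , (λ only G degs → edgeSum≈r*n⇒biregular K G 1≤δ f-sym minimal degs only)
  where
  1≤a : 1 ≤ a
  1≤a = NP.≤-trans 1≤δ δ≤a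
  1≤b : 1 ≤ b
  1≤b = NP.≤-trans 1≤a a≤b
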